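{- Let $G$ be a finite abelian $p$-group of exponent $p^e$ ($e\ge1$) and let $H$ be a proper subgroup with $pG\le H<G$. Then $\alpha_p(G)-\alpha_p(H)>1/(2p^e)$, unless $r_e(G)=1$, $r_e(H)=0$, and $r_i(G)=r_i(H)$ for $i=1,\dots,e-1$.
   Context: For a finite abelian $p$-group $A$ of exponent $p^{e_A}$, $r_i(A)=\log_p[p^{i-1}A:p^iA]$ and $\alpha_p(A)=\big(1+(p-1)\sum_{i=1}^{e_A}p^{e_A-i}r_i(A)\big)/p^{e_A}$ (so $\alpha_p$ of the trivial group is $1$). -}

module Defs where

open import Data.Bool using (Bool; true; false; if_then_else_)
open import Data.Nat using (ℕ; zero; suc; _+_; _*_; _∸_; _^_; NonZero)
open import Data.Nat.Properties using (m^n≢0; m*n≢0)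
import Data.Nat as ℕ
open import Data.Nat.Primality using (Prime; prime⇒nonZero)
open import Data.Fin using (Fin)
open import Data.Fin.Properties using (all?; any?)
import Data.Fin.Properties as FinP
open import Data.Fin.Subset using (Subset; _∈_; _∉_; ∣_∣; inside; outside)
open import Data.Fin.Subset.Properties using (_∈?_)
open import Data.Vec using (tabulate)
open import Data.Product using (_×_; ∃)
open import Relation.Nullary using (Dec; yes; no; ¬_)
open import Relation.Nullary.Decidable using (⌊_⌋; _×-dec_; _→-dec_)
open import Relation.Binary.PropositionalEquality using (_≡_)
open import Algebra.Structures using (IsAbelianGroup)
open import Data.Integer using (+_)
open import Data.Rational using (ℚ; _/_)

-- A finite abelian group, presented on the carrier Fin n (n = |G|).
-- Every finite abelian group is isomorphic to one of these.

record FinAbGroup : Set where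
  field
    n      : ℕ
    _+ᴳ_   : Fin n → Fin n → Fin n
    0ᴳ     : Fin n
    -ᴳ_    : Fin n → Fin n
    isAbelianGroup : IsAbelianGroup _≡_ _+ᴳ_ 0ᴳ -ᴳ_

  _·_ : ℕ → Fin n → Fin n
  zero  · x = 0ᴳ
  suc k · x = x +ᴳ (k · x)

  record IsSubgroup (H : Subset n) : Set where
    field
      0∈   : 0ᴳ ∈ H
      +∈   : ∀ {x y} → x ∈ H → y ∈ H → (x +ᴳ y) ∈ H
      -∈   : ∀ {x} → x ∈ H → (-ᴳ x) ∈ H

open FinAbGroup public

-- Bounded search: the least k ≥ start (within the given fuel) with P k;
-- returns start + fuel if none is found.

find : (ℕ → Bool) → ℕ → ℕ → ℕ
find P k zero    = k
find P k (suc f) = if P k then k else find P (suc k) f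

module Invariants (G : FinAbGroup) (p : ℕ) (pr : Prime p) where
  open FinAbGroup G using () renaming (n to N; _·_ to _∙_; 0ᴳ to 0g)

  private
    instance
      p≢0 : NonZero p
      p≢0 = prime⇒nonZero pr

  mulSet : ℕ → Subset N → Subset N
  mulSet k A = tabulate λ g →
    if ⌊ any? (λ a → (a ∈? A) ×-dec ((k ∙ a) FinP.≟ g)) ⌋ then inside else outside

  card : ℕ → Subset N → ℕ
  card i A = ∣ mulSet (p ^ i) A ∣

  -- r_i(A) = log_p [p^{i-1}A : p^iA], i.e. the k with p^k · |p^iA| = |p^{i-1}A|
  r : ℕ → Subset N → ℕ
  r i A = find (λ k → ⌊ (p ^ k * card i A) ℕ.≟ card (i ∸ 1) A ⌋) 0 (card (i ∸ 1) A)

  -- e_A : the least k with p^k · a = 0 for all a ∈ A (exponent of A is p^{e_A})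
  expo : Subset N → ℕ
  expo A = find (λ k → ⌊ all? (λ a → (a ∈? A) →-dec (((p ^ k) ∙ a) FinP.≟ 0g)) ⌋) 0 N

  sumFrom1 : (ℕ → ℕ) → ℕ → ℕ
  sumFrom1 f zero    = 0
  sumFrom1 f (suc m) = sumFrom1 f m + f (suc m)

  α : Subset N → ℚ
  α A = (+ (1 + (p ∸ 1) * sumFrom1 (λ i → p ^ (e ∸ i) * r i A) e)) / (p ^ e)
    where
      e = expo A
      instance
        nz : NonZero (p ^ e)
        nz = m^n≢0 p e

  invTwoPow : ℕ → ℚ
  invTwoPow e = (+ 1) / (2 * p ^ e)
    where
      instance
        nz : NonZero (2 * p ^ e)
        nz = m*n≢0 2 (p ^ e) {{_}} {{m^n≢0 p e}}

module Submission where

-- Write δ_i = log_p [p^i G : p^i H]. Counting |p^{i-1} G| through p^i G and through p^{i-1} H gives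
-- r_i(G) = r_i(H) + (δ_{i-1} - δ_i), and comparing the kernels of multiplication by p on p^i H ⊆ p^i G
-- shows that δ is non-increasing, with δ_0 ≥ 1 because H < G and δ_e = 0. So the weighted sum in the
-- numerator of α_p splits as W(G) = W(H) + W(Δ) with W(Δ) ≥ Σ Δ_i = δ_0 ≥ 1. If H has exponent p^e this
-- gives α_p(G) - α_p(H) ≥ (p-1)/p^e. Otherwise p^{e-1} H = 0, r_e(H) = 0 and the difference is
-- (p-1)(W(Δ) - 1)/p^e, while W(Δ) = 1 only in the exceptional case. That all the indices involved are
-- powers of p is seen by adjoining one element at a time, each step multiplying the order by p.

module AlphaGap where

  open import Algebra.Bundles using (AbelianGroup)
  open import Data.Bool using (Bool; true; false; _∨_; _∧_; if_then_else_)
  import Data.Bool.Properties as Bool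
  open import Data.Empty using (⊥; ⊥-elim)
  open import Data.Fin using (Fin; zero; suc)
  open import Data.Fin.Permutation using (Permutation; permutation; _⟨$⟩ʳ_)
  import Data.Fin.Properties as Fin
  open import Data.Fin.Subset using (Subset; _∈_; _∉_; ⊤; ∣_∣)
  open import Data.Fin.Subset.Properties using (_∈?_)
  import Data.Integer
  import Data.Integer as ℤ
  import Data.Integer.Properties as ℤ
  open import Data.Integer.Tactic.RingSolver using () renaming (solve-∀ to ℤ-solve-∀)
  open import Data.Nat
    using (ℕ; zero; suc; _+_; _*_; _^_; _∸_; _≤_; _<_; z≤n; s≤s; z<s; NonZero; >-nonZero; >-nonZero⁻¹; nonTrivial⇒n>1)
  import Data.Nat as ℕ
  open import Data.Nat.Coprimality using (prime⇒coprime; coprime-Bézout)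
  open import Data.Nat.DivMod using (_%_; _/_; m≡m%n+[m/n]*n; m%n<n)
  open import Data.Nat.GCD using (module Bézout)
  open import Data.Nat.Primality using (Prime; prime⇒nonZero; prime⇒nonTrivial)
  open import Data.Nat.Properties
  open import Data.Nat.Tactic.RingSolver using (solve-∀)
  open import Data.Product using (∃; _×_; _,_; proj₁; proj₂)
  import Data.Rational as ℚ
  import Data.Rational.Properties as ℚ
  open import Data.Rational.Unnormalised as ℚᵘ using (mkℚᵘ; *<*)
  import Data.Rational.Unnormalised.Properties as ℚᵘ
  open import Data.Sum using (inj₁; inj₂)
  open import Data.Vec using ([]; _∷_; lookup)
  open import Data.Vec.Properties using ([]=⇒lookup; lookup⇒[]=; lookup∘tabulate; lookup-replicate)
  open import Function.Base using (_∘_)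
  open import Function.Bundles using (mk⇔)
  open import Level using (0ℓ)
  open import Relation.Binary.PropositionalEquality
  open import Relation.Nullary using (¬_)
  open import Relation.Nullary.Decidable
    using (Dec; yes; no; does; isYes; isYes≗does; dec-true; dec-false; does-⇔; _×-dec_; _→-dec_)

  open import Defs using (FinAbGroup; module Invariants; find)

  open import Algebra.Properties.CommutativeMonoid.Sum +-0-commutativeMonoid
    using (sum; sum-cong-≗; ∑-comm; ∑-distrib-+; ∑-permute)
  open import Algebra.Properties.Semiring.Sum +-*-semiring using (*-distribʳ-sum)
  open import Algebra.Properties.CommutativeSemigroup +-commutativeSemigroup using () renaming (interchange to +-interchange)

  indicator : Bool → ℕ
  indicator b = if b then 1 else 0

  bool-ext : ∀ {a b : Bool} → (a ≡ true → b ≡ true) → (b ≡ true → a ≡ true) → a ≡ b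
  bool-ext a⇒b b⇒a = Bool.⇔→≡ {z = true} (mk⇔ a⇒b b⇒a)

  does-true⇒ : ∀ {A : Set} (a? : Dec A) → does a? ≡ true → A
  does-true⇒ (yes a) _ = a

  indicator-∧ : ∀ a b → indicator (a ∧ b) ≡ indicator a * indicator b
  indicator-∧ false b = refl
  indicator-∧ true  b = sym (+-identityʳ (indicator b))

  indicator-mono : ∀ {a b} → (a ≡ true → b ≡ true) → indicator a ≤ indicator b
  indicator-mono {false} a⇒b = z≤n
  indicator-mono {true}  a⇒b rewrite a⇒b refl = ≤-refl

  sum-mono : ∀ {n} {f g : Fin n → ℕ} → (∀ x → f x ≤ g x) → sum f ≤ sum g
  sum-mono {zero}  f≤g = z≤n
  sum-mono {suc n} f≤g = +-mono-≤ (f≤g zero) (sum-mono (λ x → f≤g (suc x)))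

  sum-zero : ∀ {n} {f : Fin n → ℕ} → (∀ x → f x ≡ 0) → sum f ≡ 0
  sum-zero {zero}  f≡0 = refl
  sum-zero {suc n} f≡0 = cong₂ _+_ (f≡0 zero) (sum-zero (λ x → f≡0 (suc x)))

  sum-strict : ∀ {n} {f g : Fin n → ℕ} → (∀ x → f x ≤ g x) → ∀ x → f x < g x → sum f < sum g
  sum-strict {suc n} f≤g zero    fx<gx = +-mono-<-≤ fx<gx (sum-mono (λ y → f≤g (suc y)))
  sum-strict {suc n} f≤g (suc x) fx<gx = +-mono-≤-< (f≤g zero) (sum-strict (λ y → f≤g (suc y)) x fx<gx)

  sum-indicator-≡ : ∀ {n} (x : Fin n) → sum (λ t → indicator (does (x Fin.≟ t))) ≡ 1
  sum-indicator-≡ {suc n} zero    = cong suc (sum-zero {n} (λ _ → refl))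
  sum-indicator-≡ {suc n} (suc x) = sum-indicator-≡ {n} x

  count : ∀ {n} → (Fin n → Bool) → ℕ
  count P = sum (λ x → indicator (P x))

  _⊆ᵇ_ : ∀ {n} → (Fin n → Bool) → (Fin n → Bool) → Set
  P ⊆ᵇ Q = ∀ x → P x ≡ true → Q x ≡ true

  module _ {n : ℕ} {P Q : Fin n → Bool} where

    count-cong : (∀ x → P x ≡ Q x) → count P ≡ count Q
    count-cong P≗Q = sum-cong-≗ {n} (λ x → cong indicator (P≗Q x))

    count-mono : P ⊆ᵇ Q → count P ≤ count Q
    count-mono P⊆Q = sum-mono (λ x → indicator-mono (P⊆Q x))

    count-strict : P ⊆ᵇ Q → ∀ x → P x ≡ false → Q x ≡ true → count P < count Q
    count-strict P⊆Q x Px Qx =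
      sum-strict (λ y → indicator-mono (P⊆Q y)) x (subst₂ (λ a b → indicator a < indicator b) (sym Px) (sym Qx) ≤-refl)

    ⊆ᵇ∧count≡⇒⊇ᵇ : P ⊆ᵇ Q → count P ≡ count Q → Q ⊆ᵇ P
    ⊆ᵇ∧count≡⇒⊇ᵇ P⊆Q #P≡#Q x Qx with P x in Px
    ... | true  = refl
    ... | false = ⊥-elim (<-irrefl #P≡#Q (count-strict P⊆Q x Px Qx))

    count-disjoint-∨ : (∀ x → P x ≡ true → Q x ≡ true → ⊥) → count (λ x → P x ∨ Q x) ≡ count P + count Q
    count-disjoint-∨ disjoint = trans (sum-cong-≗ {n} indicator-∨) (∑-distrib-+ {n} _ _)
      where
        indicator-∨ : ∀ x → indicator (P x ∨ Q x) ≡ indicator (P x) + indicator (Q x)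
        indicator-∨ x with P x in Px | Q x in Qx
        ... | false | _     = refl
        ... | true  | false = refl
        ... | true  | true  = ⊥-elim (disjoint x Px Qx)

  count-≥1 : ∀ {n} {P : Fin n → Bool} x → P x ≡ true → 1 ≤ count P
  count-≥1 {n} {P} x Px = subst (_< count P) (sum-zero {n} (λ _ → refl)) (count-strict {P = λ _ → false} (λ _ ()) x refl Px)

  count-true : ∀ {n} → count {n} (λ _ → true) ≡ n
  count-true {zero}  = refl
  count-true {suc n} = cong suc (count-true {n})

  count-permute : ∀ {n} (P : Fin n → Bool) (π : Permutation n n) → count P ≡ count (λ x → P (π ⟨$⟩ʳ x))
  count-permute P π = ∑-permute (λ x → indicator (P x)) π

  module Group (G : FinAbGroup) where
    open FinAbGroup G using (0ᴳ; -ᴳ_) renaming (n to N; _+ᴳ_ to infixl 6 _⊕_; _·_ to infixr 7 _·_)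

    abelianGroup : AbelianGroup 0ℓ 0ℓ
    abelianGroup = record { isAbelianGroup = FinAbGroup.isAbelianGroup G }

    open AbelianGroup abelianGroup using (assoc; comm; identityˡ; identityʳ; inverseˡ; inverseʳ; monoid; commutativeMonoid; rawMonoid)
    open import Algebra.Properties.CommutativeSemigroup (AbelianGroup.commutativeSemigroup abelianGroup) using (interchange)
    open import Algebra.Definitions.RawMonoid rawMonoid using () renaming (_×_ to _×ᴹ_)
    open import Algebra.Properties.Monoid.Mult monoid using (×-homo-+; ×-assocˡ)
    open import Algebra.Properties.CommutativeMonoid.Mult commutativeMonoid using (×-distrib-+)
    open import Algebra.Properties.Group (AbelianGroup.group abelianGroup) using (identityˡ-unique)

    ·≗× : ∀ k x → k · x ≡ k ×ᴹ x
    ·≗× zero    x = refl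
    ·≗× (suc k) x = cong (x ⊕_) (·≗× k x)

    ·-homo-+ : ∀ a b x → (a + b) · x ≡ a · x ⊕ b · x
    ·-homo-+ a b x rewrite ·≗× (a + b) x | ·≗× a x | ·≗× b x = ×-homo-+ x a b

    ·-assoc : ∀ a b x → (a * b) · x ≡ a · (b · x)
    ·-assoc a b x rewrite ·≗× (a * b) x | ·≗× b x | ·≗× a (b ×ᴹ x) = sym (×-assocˡ x a b)

    ·-distrib-⊕ : ∀ k x y → k · (x ⊕ y) ≡ k · x ⊕ k · y
    ·-distrib-⊕ k x y rewrite ·≗× k (x ⊕ y) | ·≗× k x | ·≗× k y = ×-distrib-+ x y k

    ·-zeroʳ : ∀ k → k · 0ᴳ ≡ 0ᴳ
    ·-zeroʳ zero    = refl
    ·-zeroʳ (suc k) = trans (cong (0ᴳ ⊕_) (·-zeroʳ k)) (identityˡ 0ᴳ)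

    translation : Fin N → Permutation N N
    translation a = permutation (_⊕ a) (_⊕ (-ᴳ a)) (cancel (inverseˡ a)) (cancel (inverseʳ a))
      where
        cancel : ∀ {b c} → c ⊕ b ≡ 0ᴳ → ∀ y → (y ⊕ c) ⊕ b ≡ y
        cancel c⊕b≡0 y = trans (assoc y _ _) (trans (cong (y ⊕_) c⊕b≡0) (identityʳ y))

    record IsSubmonoid (S : Fin N → Bool) : Set where
      field
        0∈ : S 0ᴳ ≡ true
        ⊕∈ : ∀ {x y} → S x ≡ true → S y ≡ true → S (x ⊕ y) ≡ true

      ·∈ : ∀ k {x} → S x ≡ true → S (k · x) ≡ true
      ·∈ zero    Sx = 0∈
      ·∈ (suc k) Sx = ⊕∈ Sx (·∈ k Sx)

      *·∈ : ∀ a b {x} → S (b · x) ≡ true → S ((a * b) · x) ≡ true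
      *·∈ a b {x} Sbx = subst (λ y → S y ≡ true) (sym (·-assoc a b x)) (·∈ a Sbx)

      -- Translation by a ∈ S permutes G and maps S into S, hence maps S onto S:
      -- in a finite group a submonoid is a subgroup.
      translate-invariant : ∀ {a} → S a ≡ true → ∀ x → S (x ⊕ a) ≡ S x
      translate-invariant {a} Sa x =
        bool-ext (⊆ᵇ∧count≡⇒⊇ᵇ (λ y Sy → ⊕∈ Sy Sa) (count-permute S (translation a)) x) (λ Sx → ⊕∈ Sx Sa)

      ∈-cancelˡ : ∀ {a b} → S a ≡ true → S (a ⊕ b) ≡ true → S b ≡ true
      ∈-cancelˡ {a} {b} Sa Sa⊕b = trans (sym (translate-invariant Sa b)) (trans (cong S (comm b a)) Sa⊕b)

      ∈-cancelʳ : ∀ {a b} → S b ≡ true → S (a ⊕ b) ≡ true → S a ≡ true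
      ∈-cancelʳ {a} {b} Sb Sa⊕b = ∈-cancelˡ Sb (trans (cong S (comm b a)) Sa⊕b)

      suc·∈⇒∈ : ∀ k {x} → S (k · x) ≡ true → S (suc k · x) ≡ true → S x ≡ true
      suc·∈⇒∈ k {x} Skx Sx⊕kx = ∈-cancelˡ Skx (trans (cong S (comm (k · x) x)) Sx⊕kx)

      -- p x and d x in S with d coprime to p: a Bézout identity 1 + u d = v p (or the mirror one)
      -- puts both (u d) x and (1 + u d) x in S.
      prime-·∈⇒∈ : ∀ {p} → Prime p → ∀ {d x} → 0 < d → d < p → S (p · x) ≡ true → S (d · x) ≡ true → S x ≡ true
      prime-·∈⇒∈ {p} p-prime {suc d} {x} _ d<p Spx Sdx with coprime-Bézout (prime⇒coprime p-prime d<p)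
      ... | Bézout.+- v u 1+ud≡vp =
        suc·∈⇒∈ (u * suc d) (*·∈ u (suc d) Sdx) (subst (λ m → S (m · x) ≡ true) (sym 1+ud≡vp) (*·∈ v p Spx))
      ... | Bézout.-+ v u 1+vp≡ud =
        suc·∈⇒∈ (v * p) (*·∈ v p Spx) (subst (λ m → S (m · x) ≡ true) (sym 1+vp≡ud) (*·∈ u (suc d) Sdx))

    image : ℕ → (Fin N → Bool) → Fin N → Bool
    image k S g = does (Fin.any? λ a → (S a Bool.≟ true) ×-dec (k · a Fin.≟ g))

    module _ (k : ℕ) (S : Fin N → Bool) where

      image-elim : ∀ {g} → image k S g ≡ true → ∃ λ a → S a ≡ true × k · a ≡ g
      image-elim = does-true⇒ (Fin.any? _)

      image-intro : ∀ {a g} → S a ≡ true → k · a ≡ g → image k S g ≡ true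
      image-intro {a} Sa ka≡g = dec-true (Fin.any? _) (a , Sa , ka≡g)

    image-mono : ∀ k {S T} → S ⊆ᵇ T → image k S ⊆ᵇ image k T
    image-mono k {S} {T} S⊆T g ∈kS with image-elim k S ∈kS
    ... | a , Sa , ka≡g = image-intro k T (S⊆T a Sa) ka≡g

    image-* : ∀ a b S g → image (a * b) S g ≡ image a (image b S) g
    image-* a b S g = bool-ext to from
      where
        to : image (a * b) S g ≡ true → image a (image b S) g ≡ true
        to ∈abS with image-elim (a * b) S ∈abS
        ... | x , Sx , abx≡g = image-intro a _ (image-intro b S Sx refl) (trans (sym (·-assoc a b x)) abx≡g)
        from : image a (image b S) g ≡ true → image (a * b) S g ≡ true
        from ∈abS with image-elim a (image b S) ∈abS
        ... | y , ∈bS , ay≡g with image-elim b S ∈bS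
        ...   | x , Sx , bx≡y = image-intro (a * b) S Sx (trans (·-assoc a b x) (trans (cong (a ·_) bx≡y) ay≡g))

    image-1 : ∀ S g → image 1 S g ≡ S g
    image-1 S g = bool-ext to (λ Sg → image-intro 1 S Sg (identityʳ g))
      where
        to : image 1 S g ≡ true → S g ≡ true
        to ∈S with image-elim 1 S ∈S
        ... | a , Sa , 1a≡g = subst (λ y → S y ≡ true) (trans (sym (identityʳ a)) 1a≡g) Sa

    image-isSubmonoid : ∀ k {S} → IsSubmonoid S → IsSubmonoid (image k S)
    image-isSubmonoid k {S} S-sub = record
      { 0∈ = image-intro k S (IsSubmonoid.0∈ S-sub) (·-zeroʳ k)
      ; ⊕∈ = ⊕∈ }
      where
        ⊕∈ : ∀ {x y} → image k S x ≡ true → image k S y ≡ true → image k S (x ⊕ y) ≡ true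
        ⊕∈ ∈x ∈y with image-elim k S ∈x | image-elim k S ∈y
        ... | a , Sa , ka≡x | b , Sb , kb≡y =
          image-intro k S (IsSubmonoid.⊕∈ S-sub Sa Sb) (trans (·-distrib-⊕ k a b) (cong₂ _⊕_ ka≡x kb≡y))

    fibre : ℕ → (Fin N → Bool) → Fin N → Fin N → Bool
    fibre k S t x = does (k · x Fin.≟ t) ∧ S x

    kernel : ℕ → (Fin N → Bool) → Fin N → Bool
    kernel k S = fibre k S 0ᴳ

    kernel-mono : ∀ k {S T} → S ⊆ᵇ T → kernel k S ⊆ᵇ kernel k T
    kernel-mono k {S} S⊆T x ∈ker with does (k · x Fin.≟ 0ᴳ) | S x in Sx
    ... | true | true = S⊆T x Sx

    module _ {S : Fin N → Bool} (S-sub : IsSubmonoid S) (k : ℕ) where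
      open IsSubmonoid S-sub using (translate-invariant)

      count-fibre : ∀ t → count (fibre k S t) ≡ indicator (image k S t) * count (kernel k S)
      count-fibre t with image k S t in t∈kS
      ... | true with image-elim k S t∈kS
      ...   | a , Sa , ka≡t = trans (count-permute _ (translation a)) (trans (count-cong shift) (sym (+-identityʳ _)))
        where
          fibre⇒kernel : ∀ x → k · (x ⊕ a) ≡ t → k · x ≡ 0ᴳ
          fibre⇒kernel x eq = identityˡ-unique (k · x) t (trans (cong (k · x ⊕_) (sym ka≡t)) (trans (sym (·-distrib-⊕ k x a)) eq))
          kernel⇒fibre : ∀ x → k · x ≡ 0ᴳ → k · (x ⊕ a) ≡ t
          kernel⇒fibre x eq = trans (·-distrib-⊕ k x a) (trans (cong₂ _⊕_ eq ka≡t) (identityˡ t))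
          shift : ∀ x → fibre k S t (x ⊕ a) ≡ kernel k S x
          shift x = cong₂ _∧_ (does-⇔ (mk⇔ (fibre⇒kernel x) (kernel⇒fibre x)) (k · (x ⊕ a) Fin.≟ t) (k · x Fin.≟ 0ᴳ))
                              (translate-invariant Sa x)
      count-fibre t | false = sum-zero empty
        where
          empty : ∀ x → indicator (fibre k S t x) ≡ 0
          empty x with k · x Fin.≟ t | S x in Sx
          ... | no _      | _     = refl
          ... | yes _     | false = refl
          ... | yes kx≡t  | true  with () ← trans (sym (image-intro k S Sx kx≡t)) t∈kS

      count≡count-image*count-kernel : count S ≡ count (image k S) * count (kernel k S)
      count≡count-image*count-kernel = begin
        sum (λ x → indicator (S x))                               ≡⟨ sum-cong-≗ {N} (λ x → sym (fibres-cover x)) ⟩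
        sum (λ x → sum (λ t → indicator (fibre k S t x)))         ≡⟨ ∑-comm {N} {N} (λ x t → indicator (fibre k S t x)) ⟩
        sum (λ t → count (fibre k S t))                           ≡⟨ sum-cong-≗ {N} count-fibre ⟩
        sum (λ t → indicator (image k S t) * count (kernel k S))  ≡⟨ *-distribʳ-sum {N} _ (λ t → indicator (image k S t)) ⟨
        count (image k S) * count (kernel k S)                    ∎
        where
          open ≡-Reasoning
          fibres-cover : ∀ x → sum (λ t → indicator (fibre k S t x)) ≡ indicator (S x)
          fibres-cover x = begin
            sum (λ t → indicator (fibre k S t x))                        ≡⟨ sum-cong-≗ {N} (λ t → indicator-∧ _ (S x)) ⟩
            sum (λ t → indicator (does (k · x Fin.≟ t)) * indicator (S x)) ≡⟨ *-distribʳ-sum {N} _ (λ t → indicator (does (k · x Fin.≟ t))) ⟨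
            sum (λ t → indicator (does (k · x Fin.≟ t))) * indicator (S x) ≡⟨ cong (_* indicator (S x)) (sum-indicator-≡ (k · x)) ⟩
            1 * indicator (S x)                                          ≡⟨ *-identityˡ _ ⟩
            indicator (S x)                                              ∎

    module Extension {S : Fin N → Bool} (S-sub : IsSubmonoid S) {p : ℕ} (p-prime : Prime p)
                     {x : Fin N} (x∉S : S x ≡ false) (px∈S : S (p · x) ≡ true) where
      open IsSubmonoid S-sub

      private
        instance
          p≢0 : NonZero p
          p≢0 = prime⇒nonZero p-prime

      x∈S⇒⊥ : S x ≡ true → ⊥
      x∈S⇒⊥ Sx with () ← trans (sym Sx) x∉S

      -- extended p is the subgroup generated by S and x
      extended : ℕ → Fin N → Bool
      extended zero    y = false
      extended (suc j) y = extended j y ∨ S (y ⊕ j · x)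

      extended-elim : ∀ j {y} → extended j y ≡ true → ∃ λ i → i < j × S (y ⊕ i · x) ≡ true
      extended-elim (suc j) {y} ∈ext with extended j y in ∈ext′
      ... | true  with i , i<j , S[y⊕ix] ← extended-elim j ∈ext′ = i , m<n⇒m<1+n i<j , S[y⊕ix]
      ... | false = j , ≤-refl , ∈ext

      extended-intro : ∀ {i j y} → i < j → S (y ⊕ i · x) ≡ true → extended j y ≡ true
      extended-intro {i} {suc j} {y} i<1+j S[y⊕ix] with extended j y in ∈ext
      ... | true  = refl
      ... | false with m<1+n⇒m<n∨m≡n i<1+j
      ...   | inj₁ i<j  with () ← trans (sym (extended-intro i<j S[y⊕ix])) ∈ext
      ...   | inj₂ refl = S[y⊕ix]

      reduce-mod-p : ∀ i {y} → S (y ⊕ i · x) ≡ true → S (y ⊕ (i % p) · x) ≡ true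
      reduce-mod-p i {y} S[y⊕ix] = ∈-cancelʳ (*·∈ (i / p) p px∈S) (subst (λ z → S z ≡ true) split S[y⊕ix])
        where
          split : y ⊕ i · x ≡ (y ⊕ (i % p) · x) ⊕ (i / p * p) · x
          split = trans (cong (λ m → y ⊕ m · x) (m≡m%n+[m/n]*n i p))
                        (trans (cong (y ⊕_) (·-homo-+ (i % p) (i / p * p) x)) (sym (assoc y _ _)))

      ∈extended : ∀ i {y} → S (y ⊕ i · x) ≡ true → extended p y ≡ true
      ∈extended i S[y⊕ix] = extended-intro (m%n<n i p) (reduce-mod-p i S[y⊕ix])

      ⊆extended : S ⊆ᵇ extended p
      ⊆extended y Sy = ∈extended 0 (subst (λ z → S z ≡ true) (sym (identityʳ y)) Sy)

      x∈extended : extended p x ≡ true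
      x∈extended = ∈extended (p ∸ 1) (subst (λ m → S (m · x) ≡ true) (sym (m+[n∸m]≡n (>-nonZero⁻¹ p))) px∈S)

      extended-isSubmonoid : IsSubmonoid (extended p)
      extended-isSubmonoid = record { 0∈ = ⊆extended 0ᴳ 0∈ ; ⊕∈ = ⊕∈′ }
        where
          ⊕∈′ : ∀ {y z} → extended p y ≡ true → extended p z ≡ true → extended p (y ⊕ z) ≡ true
          ⊕∈′ {y} {z} ∈y ∈z with extended-elim p ∈y | extended-elim p ∈z
          ... | i , _ , S[y⊕ix] | j , _ , S[z⊕jx] = ∈extended (i + j) (subst (λ w → S w ≡ true) regroup (⊕∈ S[y⊕ix] S[z⊕jx]))
            where
              regroup : (y ⊕ i · x) ⊕ (z ⊕ j · x) ≡ (y ⊕ z) ⊕ (i + j) · x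
              regroup = trans (interchange y (i · x) z (j · x)) (cong ((y ⊕ z) ⊕_) (sym (·-homo-+ i j x)))

      translates-disjoint : ∀ {j} → j < p → ∀ y → extended j y ≡ true → S (y ⊕ j · x) ≡ true → ⊥
      translates-disjoint {j} j<p y ∈ext S[y⊕jx] with extended-elim j ∈ext
      ... | i , i<j , S[y⊕ix] = x∈S⇒⊥ (prime-·∈⇒∈ p-prime (m<n⇒0<n∸m i<j) (≤-<-trans (m∸n≤m j i) j<p) px∈S S[dx])
        where
          regroup : y ⊕ j · x ≡ (y ⊕ i · x) ⊕ (j ∸ i) · x
          regroup = trans (cong (λ m → y ⊕ m · x) (sym (m+[n∸m]≡n (<⇒≤ i<j))))
                          (trans (cong (y ⊕_) (·-homo-+ i (j ∸ i) x)) (sym (assoc y _ _)))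
          S[dx] : S ((j ∸ i) · x) ≡ true
          S[dx] = ∈-cancelˡ S[y⊕ix] (subst (λ w → S w ≡ true) regroup S[y⊕jx])

      count-extended : ∀ j → j ≤ p → count (extended j) ≡ j * count S
      count-extended zero    _       = sum-zero {N} (λ _ → refl)
      count-extended (suc j) 1+j≤p = begin
        count (λ y → extended j y ∨ S (y ⊕ j · x))       ≡⟨ count-disjoint-∨ (translates-disjoint 1+j≤p) ⟩
        count (extended j) + count (λ y → S (y ⊕ j · x)) ≡⟨ cong₂ _+_ (count-extended j (<⇒≤ 1+j≤p))
                                                                      (sym (count-permute S (translation (j · x)))) ⟩
        j * count S + count S                             ≡⟨ +-comm (j * count S) _ ⟩
        suc j * count S                                   ∎
        where open ≡-Reasoning

      extended-least : ∀ {T} → IsSubmonoid T → S ⊆ᵇ T → T x ≡ true → extended p ⊆ᵇ T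
      extended-least T-sub S⊆T Tx y ∈ext with extended-elim p ∈ext
      ... | i , _ , S[y⊕ix] = IsSubmonoid.∈-cancelʳ T-sub (IsSubmonoid.·∈ T-sub i Tx) (S⊆T _ S[y⊕ix])

    index-prime-power : ∀ {p} → Prime p → ∀ {S L} → IsSubmonoid S → IsSubmonoid L → S ⊆ᵇ L →
                        (∀ y → L y ≡ true → S (p · y) ≡ true) → ∃ λ t → count L ≡ p ^ t * count S
    index-prime-power {p} p-prime {L = L} S-sub L-sub S⊆L pL⊆S = go (count L) S-sub S⊆L pL⊆S (m≤m+n _ _)
      where
        go : ∀ fuel {S} → IsSubmonoid S → S ⊆ᵇ L → (∀ y → L y ≡ true → S (p · y) ≡ true) →
             count L ≤ fuel + count S → ∃ λ t → count L ≡ p ^ t * count S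
        go fuel {S} S-sub S⊆L pL⊆S bound with Fin.any? (λ y → (L y Bool.≟ true) ×-dec (S y Bool.≟ false))
        ... | no ∄x = 0 , trans (≤-antisym (count-mono L⊆S) (count-mono S⊆L)) (sym (+-identityʳ _))
          where
            L⊆S : L ⊆ᵇ S
            L⊆S y Ly with S y in Sy
            ... | true  = refl
            ... | false = ⊥-elim (∄x (y , Ly , Sy))
        ... | yes (x , Lx , x∉S) = step fuel bound
          where
            open Extension S-sub p-prime x∉S (pL⊆S x Lx)
            step : ∀ fuel → count L ≤ fuel + count S → ∃ λ t → count L ≡ p ^ t * count S
            step zero        bound′ = ⊥-elim (<-irrefl refl (<-≤-trans (count-strict S⊆L x x∉S Lx) bound′))
            step (suc fuel′) bound′ with go fuel′ extended-isSubmonoid (extended-least L-sub S⊆L Lx) (λ y Ly → ⊆extended _ (pL⊆S y Ly))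
                                           (≤-trans bound′ (subst (_≤ fuel′ + count (extended p)) (+-suc fuel′ (count S))
                                                                   (+-monoʳ-≤ fuel′ (count-strict ⊆extended x x∉S x∈extended))))
            ... | t , #L≡pᵗ#ext = suc t , trans #L≡pᵗ#ext (trans (cong (p ^ t *_) (count-extended p ≤-refl))
                                              (trans (sym (*-assoc (p ^ t) p _)) (cong (_* count S) (*-comm (p ^ t) p))))

  sum₁ : (ℕ → ℕ) → ℕ → ℕ
  sum₁ f zero    = 0
  sum₁ f (suc m) = sum₁ f m + f (suc m)

  private
    init : ∀ {m} {P : ℕ → Set} → (∀ i → 1 ≤ i → i ≤ suc m → P i) → ∀ i → 1 ≤ i → i ≤ m → P i
    init h i 1≤i i≤m = h i 1≤i (m≤n⇒m≤1+n i≤m)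

    top : ∀ {m} {P : ℕ → Set} → (∀ i → 1 ≤ i → i ≤ suc m → P i) → P (suc m)
    top h = h _ (s≤s z≤n) ≤-refl

  module _ {f g : ℕ → ℕ} where

    sum₁-cong : ∀ m → (∀ i → 1 ≤ i → i ≤ m → f i ≡ g i) → sum₁ f m ≡ sum₁ g m
    sum₁-cong zero    _   = refl
    sum₁-cong (suc m) f≗g = cong₂ _+_ (sum₁-cong m (init f≗g)) (top f≗g)

    sum₁-mono : ∀ m → (∀ i → 1 ≤ i → i ≤ m → f i ≤ g i) → sum₁ f m ≤ sum₁ g m
    sum₁-mono zero    _   = z≤n
    sum₁-mono (suc m) f≤g = +-mono-≤ (sum₁-mono m (init f≤g)) (top f≤g)

    sum₁-distrib-+ : ∀ m → sum₁ (λ i → f i + g i) m ≡ sum₁ f m + sum₁ g m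
    sum₁-distrib-+ zero    = refl
    sum₁-distrib-+ (suc m) =
      trans (cong (_+ (f (suc m) + g (suc m))) (sum₁-distrib-+ m)) (+-interchange (sum₁ f m) (sum₁ g m) (f (suc m)) (g (suc m)))

    *-distribˡ-sum₁ : ∀ c m → (∀ i → 1 ≤ i → i ≤ m → g i ≡ c * f i) → sum₁ g m ≡ c * sum₁ f m
    *-distribˡ-sum₁ c zero    _     = sym (*-zeroʳ c)
    *-distribˡ-sum₁ c (suc m) g≗c*f =
      trans (cong₂ _+_ (*-distribˡ-sum₁ c m (init g≗c*f)) (top g≗c*f)) (sym (*-distribˡ-+ c (sum₁ f m) (f (suc m))))

  term≤sum₁ : ∀ (f : ℕ → ℕ) m i → 1 ≤ i → i ≤ m → f i ≤ sum₁ f m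
  term≤sum₁ f zero    (suc _) _ ()
  term≤sum₁ f (suc m) i 1≤i i≤1+m with m<1+n⇒m<n∨m≡n (s≤s i≤1+m)
  ... | inj₁ i<1+m = ≤-trans (term≤sum₁ f m i 1≤i (≤-pred i<1+m)) (m≤m+n _ _)
  ... | inj₂ refl  = m≤n+m _ _

  drop : (ℕ → ℕ) → ℕ → ℕ
  drop δ i = δ (i ∸ 1) ∸ δ i

  sum₁-drop : ∀ δ m → (∀ i → i < m → δ (suc i) ≤ δ i) → sum₁ (drop δ) m + δ m ≡ δ 0
  sum₁-drop δ zero    _          = refl
  sum₁-drop δ (suc m) δ-antitone = begin
    sum₁ (drop δ) m + (δ m ∸ δ (suc m)) + δ (suc m)  ≡⟨ +-assoc (sum₁ (drop δ) m) _ _ ⟩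
    sum₁ (drop δ) m + (δ m ∸ δ (suc m) + δ (suc m))  ≡⟨ cong (sum₁ (drop δ) m +_) (m∸n+n≡m (δ-antitone m ≤-refl)) ⟩
    sum₁ (drop δ) m + δ m                             ≡⟨ sum₁-drop δ m (λ i i<m → δ-antitone i (m<n⇒m<1+n i<m)) ⟩
    δ 0                                               ∎
    where open ≡-Reasoning

  module Weighted (p : ℕ) .{{_ : NonZero p}} where

    weighted : (ℕ → ℕ) → ℕ → ℕ
    weighted f E = sum₁ (λ i → p ^ (E ∸ i) * f i) E

    weighted-suc : ∀ f E → weighted f (suc E) ≡ p * weighted f E + f (suc E)
    weighted-suc f E = cong₂ _+_ (*-distribˡ-sum₁ {λ i → p ^ (E ∸ i) * f i} p E shift) last
      where
        shift : ∀ i → 1 ≤ i → i ≤ E → p ^ (suc E ∸ i) * f i ≡ p * (p ^ (E ∸ i) * f i)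
        shift i _ i≤E = trans (cong (λ k → p ^ k * f i) (+-∸-assoc 1 i≤E)) (*-assoc p _ _)
        last : p ^ (suc E ∸ suc E) * f (suc E) ≡ f (suc E)
        last = trans (cong (λ k → p ^ k * f (suc E)) (n∸n≡0 E)) (*-identityˡ _)

    weighted-+ : ∀ {f g h} E → (∀ i → 1 ≤ i → i ≤ E → h i ≡ f i + g i) → weighted h E ≡ weighted f E + weighted g E
    weighted-+ {f} {g} {h} E h≗f+g =
      trans (sum₁-cong E (λ i 1≤i i≤E → trans (cong (p ^ (E ∸ i) *_) (h≗f+g i 1≤i i≤E)) (*-distribˡ-+ (p ^ (E ∸ i)) (f i) (g i))))
            (sum₁-distrib-+ E)

    sum₁≤weighted : ∀ f E → sum₁ f E ≤ weighted f E
    sum₁≤weighted f E = sum₁-mono E (λ i _ _ → m≤n*m (f i) (p ^ (E ∸ i)) {{m^n≢0 p (E ∸ i)}})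

    p≤weighted-suc : ∀ f E → 1 ≤ weighted f E → p ≤ weighted f (suc E)
    p≤weighted-suc f E 1≤W = begin
      p                             ≡⟨ *-identityʳ p ⟨
      p * 1                         ≤⟨ *-monoʳ-≤ p 1≤W ⟩
      p * weighted f E              ≤⟨ m≤m+n _ _ ⟩
      p * weighted f E + f (suc E)  ≡⟨ weighted-suc f E ⟨
      weighted f (suc E)            ∎
      where open ≤-Reasoning

    weighted≤1⇒weighted-pred≡0 : 1 < p → ∀ f E → weighted f (suc E) ≤ 1 → weighted f E ≡ 0
    weighted≤1⇒weighted-pred≡0 1<p f E W≤1 =
      n≤0⇒n≡0 (≤-pred (≰⇒> λ 1≤W → <⇒≱ 1<p (≤-trans (p≤weighted-suc f E 1≤W) W≤1)))

    weighted≡0⇒≡0 : ∀ f E → weighted f E ≡ 0 → ∀ i → 1 ≤ i → i ≤ E → f i ≡ 0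
    weighted≡0⇒≡0 f E W≡0 i 1≤i i≤E =
      n≤0⇒n≡0 (≤-trans (term≤sum₁ f E i 1≤i i≤E) (≤-trans (sum₁≤weighted f E) (≤-reflexive W≡0)))

    weighted≡0⇒sum₁≡0 : ∀ f E → weighted f E ≡ 0 → sum₁ f E ≡ 0
    weighted≡0⇒sum₁≡0 f E W≡0 = n≤0⇒n≡0 (≤-trans (sum₁≤weighted f E) (≤-reflexive W≡0))

    -- α_p(A) = numerator (λ i → r_i(A)) e_A / p^{e_A}
    numerator : (ℕ → ℕ) → ℕ → ℕ
    numerator f E = 1 + (p ∸ 1) * weighted f E

    module _ (1<p : 1 < p) {rG rH Δ : ℕ → ℕ} where

      private
        q = p ∸ 1
        p≡1+q : p ≡ suc q
        p≡1+q = sym (m+[n∸m]≡n (<⇒≤ 1<p))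

      numerator-split : ∀ E → (∀ i → 1 ≤ i → i ≤ E → rG i ≡ rH i + Δ i) → numerator rG E ≡ numerator rH E + q * weighted Δ E
      numerator-split E rG≗rH+Δ = cong suc (trans (cong (q *_) (weighted-+ E rG≗rH+Δ)) (*-distribˡ-+ q _ _))

      numerator-< : ∀ E → (∀ i → 1 ≤ i → i ≤ E → rG i ≡ rH i + Δ i) → 1 ≤ weighted Δ E → numerator rH E < numerator rG E
      numerator-< E rG≗rH+Δ 1≤WΔ = subst (numerator rH E <_) (sym (numerator-split E rG≗rH+Δ))
        (m<m+n _ (*-mono-≤ (≤-pred (subst (1 <_) p≡1+q 1<p)) 1≤WΔ))

      -- Numerators over p^E and p^{E+1}: the surplus p on the left is absorbed only if the weighted drop is at least 2.
      p*numerator-< : ∀ E → (∀ i → 1 ≤ i → i ≤ suc E → rG i ≡ rH i + Δ i) → rH (suc E) ≡ 0 →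
                      2 ≤ weighted Δ (suc E) → p * numerator rH E < numerator rG (suc E)
      p*numerator-< E rG≗rH+Δ rH[1+E]≡0 2≤WΔ = begin-strict
        p * (1 + q * W)                         ≡⟨ expand p q W ⟩
        q * (p * W) + p                         <⟨ +-monoʳ-< (q * (p * W)) p<1+q*WΔ ⟩
        q * (p * W) + suc (q * WΔ)              ≡⟨ +-suc _ _ ⟩
        suc (q * (p * W) + q * WΔ)              ≡⟨ cong (λ w → suc (q * w + q * WΔ)) W[1+E]≡p*W ⟨
        numerator rH (suc E) + q * WΔ           ≡⟨ numerator-split (suc E) rG≗rH+Δ ⟨
        numerator rG (suc E)                    ∎
        where
          open ≤-Reasoning
          W  = weighted rH E
          WΔ = weighted Δ (suc E)
          W[1+E]≡p*W : weighted rH (suc E) ≡ p * W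
          W[1+E]≡p*W = trans (weighted-suc rH E) (trans (cong (p * W +_) rH[1+E]≡0) (+-identityʳ _))
          p<1+q*WΔ : p < suc (q * WΔ)
          p<1+q*WΔ = s≤s (begin
            p          ≡⟨ p≡1+q ⟩
            suc q      ≤⟨ +-monoˡ-≤ q (≤-pred (subst (1 <_) p≡1+q 1<p)) ⟩
            q + q      ≡⟨ cong (q +_) (+-identityʳ q) ⟨
            2 * q      ≡⟨ *-comm 2 q ⟩
            q * 2      ≤⟨ *-monoʳ-≤ q 2≤WΔ ⟩
            q * WΔ     ∎)
          expand : ∀ p q W → p * (1 + q * W) ≡ q * (p * W) + p
          expand = solve-∀

  module _ where
    open Data.Integer using (+_)

    -- X/P - Y/Q = (X - m Y)/P ≥ 1/P when P = Q m, computed on unnormalised fractions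
    1/2P<X/P-Y/Q : ∀ X Y Q m P .{{_ : NonZero P}} .{{_ : NonZero Q}} .{{_ : NonZero (2 * P)}} →
                   P ≡ Q * m → m * Y < X → (+ 1) ℚ./ (2 * P) ℚ.< (+ X) ℚ./ P ℚ.- (+ Y) ℚ./ Q
    1/2P<X/P-Y/Q X Y Q@(suc Q-1) m P@(suc P-1) P≡Qm mY<X =
      ℚ.toℚᵘ-cancel-<
        (ℚᵘ.<-respˡ-≃ (ℚᵘ.≃-sym (ℚ.toℚᵘ-fromℚᵘ (mkℚᵘ (+ 1) (2 * P ∸ 1))))
        (ℚᵘ.<-respʳ-≃ (ℚᵘ.≃-sym toℚᵘ-difference) (*<* cross-multiplied)))
      where
        toℚᵘ-difference : ℚ.toℚᵘ ((+ X) ℚ./ P ℚ.- (+ Y) ℚ./ Q) ℚᵘ.≃ mkℚᵘ (+ X) P-1 ℚᵘ.- mkℚᵘ (+ Y) Q-1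
        toℚᵘ-difference = ℚᵘ.≃-trans (ℚ.toℚᵘ-homo-+ ((+ X) ℚ./ P) (ℚ.- ((+ Y) ℚ./ Q)))
          (ℚᵘ.+-cong (ℚ.toℚᵘ-fromℚᵘ (mkℚᵘ (+ X) P-1))
                     (ℚᵘ.≃-trans (ℚ.toℚᵘ-homo‿- ((+ Y) ℚ./ Q)) (ℚᵘ.-‿cong (ℚ.toℚᵘ-fromℚᵘ (mkℚᵘ (+ Y) Q-1)))))
        D = X ∸ m * Y
        numerator≡ : (+ X) ℤ.* (+ Q) ℤ.+ (ℤ.- (+ Y)) ℤ.* (+ P) ≡ + (D * Q)
        numerator≡ = begin
          (+ X) ℤ.* (+ Q) ℤ.+ (ℤ.- (+ Y)) ℤ.* (+ P)
            ≡⟨ cong₂ (λ u v → u ℤ.* (+ Q) ℤ.+ (ℤ.- (+ Y)) ℤ.* v)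
                 (trans (cong +_ (sym (m+[n∸m]≡n (<⇒≤ mY<X)))) (trans (ℤ.pos-+ (m * Y) D) (cong (ℤ._+ (+ D)) (ℤ.pos-* m Y))))
                 (trans (cong +_ P≡Qm) (ℤ.pos-* Q m)) ⟩
          ((+ m) ℤ.* (+ Y) ℤ.+ (+ D)) ℤ.* (+ Q) ℤ.+ (ℤ.- (+ Y)) ℤ.* ((+ Q) ℤ.* (+ m))
            ≡⟨ cancel (+ m) (+ Y) (+ D) (+ Q) ⟩
          (+ D) ℤ.* (+ Q)
            ≡⟨ ℤ.pos-* D Q ⟨
          + (D * Q) ∎
          where
            open ≡-Reasoning
            cancel : ∀ m y d q → (m ℤ.* y ℤ.+ d) ℤ.* q ℤ.+ (ℤ.- y) ℤ.* (q ℤ.* m) ≡ d ℤ.* q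
            cancel = ℤ-solve-∀
        PQ<DQ2P : P * Q < D * Q * (2 * P)
        PQ<DQ2P = begin-strict
          P * Q              ≡⟨ *-comm P Q ⟩
          Q * P              <⟨ *-monoʳ-< Q (subst (P <_) (*-comm P 2) (m<m*n P 2 ≤-refl)) ⟩
          Q * (2 * P)        ≤⟨ *-monoˡ-≤ (2 * P) (m≤n*m Q D {{>-nonZero (m<n⇒0<n∸m mY<X)}}) ⟩
          D * Q * (2 * P)    ∎
          where open ≤-Reasoning
        cross-multiplied : (+ 1) ℤ.* (+ (P * Q)) ℤ.< ((+ X) ℤ.* (+ Q) ℤ.+ (ℤ.- (+ Y)) ℤ.* (+ P)) ℤ.* (+ (2 * P))
        cross-multiplied = subst₂ ℤ._<_ (sym (ℤ.*-identityˡ (+ (P * Q))))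
                             (trans (ℤ.pos-* (D * Q) (2 * P)) (cong (ℤ._* (+ (2 * P))) (sym numerator≡)))
                             (ℤ.+<+ PQ<DQ2P)

  module Powers {p : ℕ} (1<p : 1 < p) where

    private
      instance
        p≢0 : NonZero p
        p≢0 = >-nonZero (<-trans z<s 1<p)

    ^-cancel-≤ : ∀ {a b} → p ^ a ≤ p ^ b → a ≤ b
    ^-cancel-≤ pᵃ≤pᵇ = ≮⇒≥ (λ b<a → <⇒≱ (^-monoʳ-< p 1<p b<a) pᵃ≤pᵇ)

    ^*-cancel-≤ : ∀ {a b c} → 1 ≤ c → p ^ a * c ≤ p ^ b * c → a ≤ b
    ^*-cancel-≤ {a} {b} {c} 1≤c le = ^-cancel-≤ (*-cancelʳ-≤ (p ^ a) (p ^ b) c {{>-nonZero 1≤c}} le)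

    ^*-injective : ∀ {a b c} → 1 ≤ c → p ^ a * c ≡ p ^ b * c → a ≡ b
    ^*-injective 1≤c eq = ≤-antisym (^*-cancel-≤ 1≤c (≤-reflexive eq)) (^*-cancel-≤ 1≤c (≤-reflexive (sym eq)))

    ^*≤⇒≡0 : ∀ {a c} → 1 ≤ c → p ^ a * c ≤ c → a ≡ 0
    ^*≤⇒≡0 {c = c} 1≤c le = n≤0⇒n≡0 (^*-cancel-≤ 1≤c (≤-trans le (≤-reflexive (sym (*-identityˡ c)))))

    n<pⁿ : ∀ n → n < p ^ n
    n<pⁿ zero    = s≤s z≤n
    n<pⁿ (suc n) = ≤-trans (s≤s (n<pⁿ n)) (^-monoʳ-< p 1<p (n<1+n n))

  find-least : ∀ P s fuel t → s ≤ t → t ≤ s + fuel → (∀ j → s ≤ j → j < t → P j ≡ false) → P t ≡ true →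
               find P s fuel ≡ t
  find-least P s zero        t s≤t t≤s+0 _ _ = ≤-antisym s≤t (subst (t ≤_) (+-identityʳ s) t≤s+0)
  find-least P s (suc fuel) t s≤t t≤s+fuel below Pt with m≤n⇒m<n∨m≡n s≤t
  ... | inj₂ refl rewrite Pt = refl
  ... | inj₁ s<t  rewrite below s ≤-refl s<t =
    find-least P (suc s) fuel t s<t (subst (t ≤_) (+-suc s fuel) t≤s+fuel) (λ j s<j j<t → below j (<⇒≤ s<j) j<t) Pt

  prime⇒1<p : ∀ {p} → Prime p → 1 < p
  prime⇒1<p {p} p-prime = nonTrivial⇒n>1 p {{prime⇒nonTrivial p-prime}}

  module Layers (G : FinAbGroup) {p : ℕ} (p-prime : Prime p) where
    open FinAbGroup G using (0ᴳ) renaming (n to N; _+ᴳ_ to infixl 6 _⊕_; _·_ to infixr 7 _·_)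
    open Group G
    open Powers (prime⇒1<p p-prime)

    private
      instance
        p≢0 : NonZero p
        p≢0 = prime⇒nonZero p-prime

    layer : (Fin N → Bool) → ℕ → Fin N → Bool
    layer S i = image (p ^ i) S

    layer-isSubmonoid : ∀ {S} → IsSubmonoid S → ∀ i → IsSubmonoid (layer S i)
    layer-isSubmonoid S-sub i = image-isSubmonoid (p ^ i) S-sub

    layer-suc : ∀ S i g → layer S (suc i) g ≡ image p (layer S i) g
    layer-suc S i = image-* p (p ^ i) S

    layer-+ : ∀ S m i g → layer S (m + i) g ≡ image (p ^ m) (layer S i) g
    layer-+ S m i g = trans (cong (λ k → image k S g) (^-distribˡ-+-* p m i)) (image-* (p ^ m) (p ^ i) S g)

    layer-suc-⊆ : ∀ {S} → IsSubmonoid S → ∀ i → layer S (suc i) ⊆ᵇ layer S i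
    layer-suc-⊆ {S} S-sub i g ∈layer with image-elim (p ^ suc i) S ∈layer
    ... | a , Sa , pⁱ⁺¹a≡g = image-intro (p ^ i) S (IsSubmonoid.·∈ S-sub p Sa)
                               (trans (sym (·-assoc (p ^ i) p a)) (trans (cong (_· a) (*-comm (p ^ i) p)) pⁱ⁺¹a≡g))

    p·∈layer-suc : ∀ S i {y} → layer S i y ≡ true → layer S (suc i) (p · y) ≡ true
    p·∈layer-suc S i ∈layer = trans (layer-suc S i _) (image-intro p (layer S i) ∈layer refl)

    count-layer≥1 : ∀ {S} → IsSubmonoid S → ∀ i → 1 ≤ count (layer S i)
    count-layer≥1 S-sub i = count-≥1 0ᴳ (IsSubmonoid.0∈ (layer-isSubmonoid S-sub i))

    module _ {S : Fin N → Bool} (S-sub : IsSubmonoid S) where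

      private
        rank-exists : ∀ i → ∃ λ t → count (layer S i) ≡ p ^ t * count (layer S (suc i))
        rank-exists i = index-prime-power p-prime (layer-isSubmonoid S-sub (suc i)) (layer-isSubmonoid S-sub i)
                          (layer-suc-⊆ S-sub i) (λ _ → p·∈layer-suc S i)

      -- rank i = log_p [p^i S : p^{i+1} S], so that r_{i+1}(S) = rank i
      rank : ℕ → ℕ
      rank i = proj₁ (rank-exists i)

      count-layer-rank : ∀ i → count (layer S i) ≡ p ^ rank i * count (layer S (suc i))
      count-layer-rank i = proj₂ (rank-exists i)

    Annihilates : ℕ → (Fin N → Bool) → Set
    Annihilates k S = ∀ a → S a ≡ true → k · a ≡ 0ᴳ

    annihilates? : ∀ k S → Dec (Annihilates k S)
    annihilates? k S = Fin.all? λ a → (S a Bool.≟ true) →-dec (k · a Fin.≟ 0ᴳ)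

    annihilates-mono : ∀ {S j k} → j ≤ k → Annihilates (p ^ j) S → Annihilates (p ^ k) S
    annihilates-mono {j = j} {k} j≤k pʲS≡0 a Sa = begin
      p ^ k · a                    ≡⟨ cong (λ m → p ^ m · a) (m∸n+n≡m j≤k) ⟨
      p ^ (k ∸ j + j) · a          ≡⟨ cong (_· a) (^-distribˡ-+-* p (k ∸ j) j) ⟩
      (p ^ (k ∸ j) * p ^ j) · a    ≡⟨ ·-assoc (p ^ (k ∸ j)) (p ^ j) a ⟩
      p ^ (k ∸ j) · p ^ j · a      ≡⟨ cong (p ^ (k ∸ j) ·_) (pʲS≡0 a Sa) ⟩
      p ^ (k ∸ j) · 0ᴳ             ≡⟨ ·-zeroʳ (p ^ (k ∸ j)) ⟩
      0ᴳ                           ∎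
      where open ≡-Reasoning

    annihilated-layer≡0 : ∀ {S k g} → Annihilates (p ^ k) S → layer S k g ≡ true → g ≡ 0ᴳ
    annihilated-layer≡0 {S} {k} pᵏS≡0 ∈layer with image-elim (p ^ k) S ∈layer
    ... | a , Sa , pᵏa≡g = trans (sym pᵏa≡g) (pᵏS≡0 a Sa)

    annihilated-layer-⊆ : ∀ {S T k} → Annihilates (p ^ k) S → IsSubmonoid T → layer S k ⊆ᵇ T
    annihilated-layer-⊆ {T = T} {k} pᵏS≡0 T-sub g ∈layer =
      subst (λ y → T y ≡ true) (sym (annihilated-layer≡0 {k = k} pᵏS≡0 ∈layer)) (IsSubmonoid.0∈ T-sub)

    module _ {S : Fin N → Bool} (S-sub : IsSubmonoid S) where

      annihilated⇒rank≡0 : ∀ {k} → Annihilates (p ^ k) S → rank S-sub k ≡ 0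
      annihilated⇒rank≡0 {k} pᵏS≡0 = ^*≤⇒≡0 (count-layer≥1 S-sub (suc k)) (begin
        p ^ rank S-sub k * count (layer S (suc k))  ≡⟨ count-layer-rank S-sub k ⟨
        count (layer S k)                           ≤⟨ count-mono (annihilated-layer-⊆ {k = k} pᵏS≡0 (layer-isSubmonoid S-sub (suc k))) ⟩
        count (layer S (suc k))                     ∎)
        where open ≤-Reasoning

      -- If p^i S = p^{i+1} S then multiplying by p^(e-i) gives p^e S = p^{e+1} S = 0.
      rank-positive : ∀ {e i} → Annihilates (p ^ suc e) S → ¬ Annihilates (p ^ e) S → i ≤ e → 1 ≤ rank S-sub i
      rank-positive {e} {i} pᵉ⁺¹S≡0 pᵉS≢0 i≤e with rank S-sub i in rank≡0
      ... | suc _ = s≤s z≤n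
      ... | zero  = ⊥-elim (pᵉS≢0 λ a Sa →
                      annihilated-layer≡0 {k = suc e} pᵉ⁺¹S≡0 (pᵉS⊆pᵉ⁺¹S (image-intro (p ^ e) S Sa refl)))
        where
          stable : layer S i ⊆ᵇ layer S (suc i)
          stable = ⊆ᵇ∧count≡⇒⊇ᵇ (layer-suc-⊆ S-sub i)
                     (sym (trans (count-layer-rank S-sub i) (trans (cong (λ t → p ^ t * _) rank≡0) (*-identityˡ _))))
          m = e ∸ i
          pᵉS⊆pᵉ⁺¹S : ∀ {g} → layer S e g ≡ true → layer S (suc e) g ≡ true
          pᵉS⊆pᵉ⁺¹S {g} ∈pᵉS = begin
            layer S (suc e) g                  ≡⟨ cong (λ k → layer S (suc k) g) (m∸n+n≡m i≤e) ⟨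
            layer S (suc (m + i)) g            ≡⟨ cong (λ k → layer S k g) (+-suc m i) ⟨
            layer S (m + suc i) g              ≡⟨ layer-+ S m (suc i) g ⟩
            image (p ^ m) (layer S (suc i)) g  ≡⟨ image-mono (p ^ m) stable g ∈pᵐpⁱS ⟩
            true                               ∎
            where
              open ≡-Reasoning
              ∈pᵐpⁱS : image (p ^ m) (layer S i) g ≡ true
              ∈pᵐpⁱS = trans (sym (layer-+ S m i g)) (trans (cong (λ k → layer S k g) (m∸n+n≡m i≤e)) ∈pᵉS)

      layer-shrinks : ∀ {e i} → Annihilates (p ^ suc e) S → ¬ Annihilates (p ^ e) S → i ≤ e → count (layer S (suc i)) < count (layer S i)
      layer-shrinks {e} {i} pᵉ⁺¹S≡0 pᵉS≢0 i≤e = begin-strict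
        count (layer S (suc i))                         ≡⟨ *-identityˡ _ ⟨
        1 * count (layer S (suc i))                     <⟨ *-monoˡ-< (count (layer S (suc i))) {{>-nonZero (count-layer≥1 S-sub (suc i))}}
                                                             (^-monoʳ-< p (prime⇒1<p p-prime) (rank-positive pᵉ⁺¹S≡0 pᵉS≢0 i≤e)) ⟩
        p ^ rank S-sub i * count (layer S (suc i))      ≡⟨ count-layer-rank S-sub i ⟨
        count (layer S i)                               ∎
        where open ≤-Reasoning

      exponent<count : ∀ {e} → Annihilates (p ^ suc e) S → ¬ Annihilates (p ^ e) S → suc e < count S
      exponent<count {e} pᵉ⁺¹S≡0 pᵉS≢0 = subst (suc e <_) (count-cong (image-1 S)) (go (suc e) 0 (+-identityʳ _))
        where
          go : ∀ k i → k + i ≡ suc e → k < count (layer S i)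
          go zero    i _          = count-layer≥1 S-sub i
          go (suc k) i 1+k+i≡1+e = ≤-trans (s≤s (go k (suc i) (trans (+-suc k i) 1+k+i≡1+e)))
                                           (layer-shrinks pᵉ⁺¹S≡0 pᵉS≢0 (subst (i ≤_) (suc-injective 1+k+i≡1+e) (m≤n+m i k)))

    count-layer≡count-layer-suc*kernel : ∀ {S} → IsSubmonoid S → ∀ i →
                                         count (layer S i) ≡ count (layer S (suc i)) * count (kernel p (layer S i))
    count-layer≡count-layer-suc*kernel {S} S-sub i =
      trans (count≡count-image*count-kernel (layer-isSubmonoid S-sub i) p)
            (cong (_* count (kernel p (layer S i))) (count-cong (λ g → sym (layer-suc S i g))))

    module Relative {S L : Fin N → Bool} (S-sub : IsSubmonoid S) (L-sub : IsSubmonoid L) (S⊆L : S ⊆ᵇ L)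
                    (pL⊆S : ∀ y → L y ≡ true → S (p · y) ≡ true) where

      private
        pLᵢ⊆Sᵢ : ∀ i y → layer L i y ≡ true → layer S i (p · y) ≡ true
        pLᵢ⊆Sᵢ i y ∈Lᵢ with image-elim (p ^ i) L ∈Lᵢ
        ... | a , La , pⁱa≡y = image-intro (p ^ i) S (pL⊆S a La)
          (trans (sym (·-assoc (p ^ i) p a)) (trans (cong (_· a) (*-comm (p ^ i) p)) (trans (·-assoc p (p ^ i) a) (cong (p ·_) pⁱa≡y))))

        relativeRank-exists : ∀ i → ∃ λ t → count (layer L i) ≡ p ^ t * count (layer S i)
        relativeRank-exists i = index-prime-power p-prime (layer-isSubmonoid S-sub i) (layer-isSubmonoid L-sub i)
                                  (image-mono (p ^ i) S⊆L) (pLᵢ⊆Sᵢ i)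

      relativeRank : ℕ → ℕ
      relativeRank i = proj₁ (relativeRank-exists i)

      count-layer-relativeRank : ∀ i → count (layer L i) ≡ p ^ relativeRank i * count (layer S i)
      count-layer-relativeRank i = proj₂ (relativeRank-exists i)

      rank+relativeRank : ∀ i → rank L-sub i + relativeRank (suc i) ≡ rank S-sub i + relativeRank i
      rank+relativeRank i = trans (^*-injective (count-layer≥1 S-sub (suc i)) (begin
        p ^ (rank L-sub i + relativeRank (suc i)) * c                ≡⟨ ^+* (rank L-sub i) (relativeRank (suc i)) ⟩
        p ^ rank L-sub i * (p ^ relativeRank (suc i) * c)            ≡⟨ cong (p ^ rank L-sub i *_) (count-layer-relativeRank (suc i)) ⟨
        p ^ rank L-sub i * count (layer L (suc i))                   ≡⟨ count-layer-rank L-sub i ⟨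
        count (layer L i)                                            ≡⟨ count-layer-relativeRank i ⟩
        p ^ relativeRank i * count (layer S i)                       ≡⟨ cong (p ^ relativeRank i *_) (count-layer-rank S-sub i) ⟩
        p ^ relativeRank i * (p ^ rank S-sub i * c)                  ≡⟨ ^+* (relativeRank i) (rank S-sub i) ⟨
        p ^ (relativeRank i + rank S-sub i) * c                      ∎))
        (+-comm (relativeRank i) (rank S-sub i))
        where
          open ≡-Reasoning
          c = count (layer S (suc i))
          ^+* : ∀ a b → p ^ (a + b) * c ≡ p ^ a * (p ^ b * c)
          ^+* a b = trans (cong (_* c) (^-distribˡ-+-* p a b)) (*-assoc (p ^ a) (p ^ b) c)

      -- Multiplication by p maps p^i L / p^i S onto p^{i+1} L / p^{i+1} S; in counts this is
      -- the comparison of the kernels of p on p^i S ⊆ p^i L.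
      relativeRank-antitone : ∀ i → relativeRank (suc i) ≤ relativeRank i
      relativeRank-antitone i = ^*-cancel-≤ (*-mono-≤ (count-layer≥1 S-sub (suc i)) kerL≥1) (begin
        p ^ relativeRank (suc i) * (c * kerL)      ≡⟨ *-assoc (p ^ relativeRank (suc i)) c kerL ⟨
        p ^ relativeRank (suc i) * c * kerL        ≡⟨ cong (_* kerL) (count-layer-relativeRank (suc i)) ⟨
        count (layer L (suc i)) * kerL             ≡⟨ count-layer≡count-layer-suc*kernel L-sub i ⟨
        count (layer L i)                          ≡⟨ count-layer-relativeRank i ⟩
        p ^ relativeRank i * count (layer S i)     ≡⟨ cong (p ^ relativeRank i *_) (count-layer≡count-layer-suc*kernel S-sub i) ⟩
        p ^ relativeRank i * (c * kerS)            ≤⟨ *-monoʳ-≤ (p ^ relativeRank i) (*-monoʳ-≤ c kerS≤kerL) ⟩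
        p ^ relativeRank i * (c * kerL)            ∎)
        where
          open ≤-Reasoning
          c    = count (layer S (suc i))
          kerS = count (kernel p (layer S i))
          kerL = count (kernel p (layer L i))
          kerS≤kerL : kerS ≤ kerL
          kerS≤kerL = count-mono (kernel-mono p (image-mono (p ^ i) S⊆L))
          kerL≥1 : 1 ≤ kerL
          kerL≥1 = count-≥1 0ᴳ (subst (λ b → b ∧ layer L i 0ᴳ ≡ true) (sym (dec-true (p · 0ᴳ Fin.≟ 0ᴳ) (·-zeroʳ p)))
                                      (IsSubmonoid.0∈ (layer-isSubmonoid L-sub i)))

      relativeRank₀-positive : ∀ {x} → S x ≡ false → L x ≡ true → 1 ≤ relativeRank 0
      relativeRank₀-positive {x} x∉S x∈L with relativeRank 0 in δ₀≡0
      ... | suc _ = s≤s z≤n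
      ... | zero  = ⊥-elim (<-irrefl #S₀≡#L₀ (subst₂ _<_ (count-cong (λ g → sym (image-1 S g))) (count-cong (λ g → sym (image-1 L g)))
                                                      (count-strict S⊆L x x∉S x∈L)))
        where
          #S₀≡#L₀ : count (layer S 0) ≡ count (layer L 0)
          #S₀≡#L₀ = sym (trans (count-layer-relativeRank 0) (trans (cong (λ t → p ^ t * _) δ₀≡0) (*-identityˡ _)))

      annihilated⇒relativeRank≡0 : ∀ {k} → Annihilates (p ^ k) L → relativeRank k ≡ 0
      annihilated⇒relativeRank≡0 {k} pᵏL≡0 = ^*≤⇒≡0 (count-layer≥1 S-sub k) (begin
        p ^ relativeRank k * count (layer S k)  ≡⟨ count-layer-relativeRank k ⟨
        count (layer L k)                       ≤⟨ count-mono (annihilated-layer-⊆ {k = k} pᵏL≡0 (layer-isSubmonoid S-sub k)) ⟩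
        count (layer S k)                       ∎)
        where open ≤-Reasoning

      rank≡rank+drop : ∀ i → rank L-sub i ≡ rank S-sub i + drop relativeRank (suc i)
      rank≡rank+drop i = +-cancelʳ-≡ (relativeRank (suc i)) _ _ (begin
        rank L-sub i + relativeRank (suc i)                                          ≡⟨ rank+relativeRank i ⟩
        rank S-sub i + relativeRank i
          ≡⟨ cong (rank S-sub i +_) (m∸n+n≡m (relativeRank-antitone i)) ⟨
        rank S-sub i + (relativeRank i ∸ relativeRank (suc i) + relativeRank (suc i)) ≡⟨ +-assoc (rank S-sub i) _ _ ⟨
        rank S-sub i + drop relativeRank (suc i) + relativeRank (suc i)              ∎)
        where open ≡-Reasoning

  ∣∣≡count-lookup : ∀ {n} (A : Subset n) → ∣ A ∣ ≡ count (lookup A)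
  ∣∣≡count-lookup []          = refl
  ∣∣≡count-lookup (true ∷ A)  = cong suc (∣∣≡count-lookup A)
  ∣∣≡count-lookup (false ∷ A) = ∣∣≡count-lookup A

  if-true-false : ∀ b → (if b then true else false) ≡ b
  if-true-false true  = refl
  if-true-false false = refl

  module LayersAsInvariants (G : FinAbGroup) {p : ℕ} (p-prime : Prime p) where
    open FinAbGroup G using (0ᴳ) renaming (n to N; _+ᴳ_ to infixl 6 _⊕_; _·_ to infixr 7 _·_)
    open Group G
    open Layers G p-prime
    open Invariants G p p-prime using (mulSet; card; r; expo; sumFrom1; α)

    card≡count-layer : ∀ i A → card i A ≡ count (layer (lookup A) i)
    card≡count-layer i A = trans (∣∣≡count-lookup (mulSet (p ^ i) A)) (count-cong mulSet≗image)
      where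
        mulSet≗image : ∀ g → lookup (mulSet (p ^ i) A) g ≡ layer (lookup A) i g
        mulSet≗image g = trans (lookup∘tabulate _ g) (trans (if-true-false _) (trans (isYes≗does _)
          (does-⇔ (mk⇔ (λ (a , a∈A , eq) → a , []=⇒lookup a∈A , eq) (λ (a , Aa , eq) → a , lookup⇒[]= a A Aa , eq))
                   (Fin.any? λ a → (a ∈? A) ×-dec (p ^ i · a Fin.≟ g))
                   (Fin.any? λ a → (lookup A a Bool.≟ true) ×-dec (p ^ i · a Fin.≟ g)))))

    private
      instance
        p≢0 : NonZero p
        p≢0 = prime⇒nonZero p-prime

    open Powers (prime⇒1<p p-prime) using (^*-injective; n<pⁿ)
    open Weighted p using (numerator)

    r≡rank : ∀ {A} (A-sub : IsSubmonoid (lookup A)) i → r (suc i) A ≡ rank A-sub i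
    r≡rank {A} A-sub i = find-least _ 0 (card i A) (rank A-sub i) z≤n t≤card below found
      where
        t  = rank A-sub i
        c′ = card (suc i) A
        card≡pᵗc′ : card i A ≡ p ^ t * c′
        card≡pᵗc′ = trans (card≡count-layer i A) (trans (count-layer-rank A-sub i) (cong (p ^ t *_) (sym (card≡count-layer (suc i) A))))
        c′≥1 : 1 ≤ c′
        c′≥1 = subst (1 ≤_) (sym (card≡count-layer (suc i) A)) (count-layer≥1 A-sub (suc i))
        t≤card : t ≤ card i A
        t≤card = ≤-trans (<⇒≤ (n<pⁿ t)) (≤-trans (m≤m*n (p ^ t) c′ {{>-nonZero c′≥1}}) (≤-reflexive (sym card≡pᵗc′)))
        below : ∀ j → 0 ≤ j → j < t → isYes (p ^ j * c′ ℕ.≟ card i A) ≡ false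
        below j _ j<t = trans (isYes≗does _) (dec-false (p ^ j * c′ ℕ.≟ card i A)
                          (λ pʲc′≡card → <-irrefl (^*-injective c′≥1 (trans pʲc′≡card card≡pᵗc′)) j<t))
        found : isYes (p ^ t * c′ ℕ.≟ card i A) ≡ true
        found = trans (isYes≗does _) (dec-true (p ^ t * c′ ℕ.≟ card i A) (sym card≡pᵗc′))

    expo≡ : ∀ A E → E ≤ N → Annihilates (p ^ E) (lookup A) → (∀ j → j < E → ¬ Annihilates (p ^ j) (lookup A)) → expo A ≡ E
    expo≡ A E E≤N pᴱA≡0 pʲA≢0 = find-least _ 0 N E z≤n E≤N
      (λ j _ j<E → trans (isYes≗does _) (dec-false (annihilates∈? j) (pʲA≢0 j j<E ∘ to {j})))
      (trans (isYes≗does _) (dec-true (annihilates∈? E) (from {E} pᴱA≡0)))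
      where
        annihilates∈? : ∀ k → Dec (∀ a → a ∈ A → p ^ k · a ≡ 0ᴳ)
        annihilates∈? k = Fin.all? λ a → (a ∈? A) →-dec (p ^ k · a Fin.≟ 0ᴳ)
        to : ∀ {k} → (∀ a → a ∈ A → p ^ k · a ≡ 0ᴳ) → Annihilates (p ^ k) (lookup A)
        to pᵏA≡0 a Aa = pᵏA≡0 a (lookup⇒[]= a A Aa)
        from : ∀ {k} → Annihilates (p ^ k) (lookup A) → ∀ a → a ∈ A → p ^ k · a ≡ 0ᴳ
        from pᵏA≡0 a a∈A = pᵏA≡0 a ([]=⇒lookup a∈A)

    sumFrom1≡sum₁ : ∀ f m → sumFrom1 f m ≡ sum₁ f m
    sumFrom1≡sum₁ f zero    = refl
    sumFrom1≡sum₁ f (suc m) = cong (_+ f (suc m)) (sumFrom1≡sum₁ f m)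

    α≡ : ∀ A E → expo A ≡ E → α A ≡ ℚ._/_ (ℤ.+ numerator (λ i → r i A) E) (p ^ E) {{m^n≢0 p E}}
    α≡ A E refl = cong (λ s → ℚ._/_ (ℤ.+ (1 + (p ∸ 1) * s)) (p ^ E) {{m^n≢0 p E}}) (sumFrom1≡sum₁ _ E)

  module Proposition (p : ℕ) (p-prime : Prime p) (G : FinAbGroup) (e : ℕ)
                     (pᵉ⁺¹G≡0 : ∀ x → FinAbGroup._·_ G (p ^ suc e) x ≡ FinAbGroup.0ᴳ G)
                     (pᵉG≢0 : ¬ (∀ x → FinAbGroup._·_ G (p ^ e) x ≡ FinAbGroup.0ᴳ G))
                     (H : Subset (FinAbGroup.n G)) (H≤G : FinAbGroup.IsSubgroup G H)
                     (pG⊆H : ∀ x → FinAbGroup._·_ G p x ∈ H) (H≢G : ∃ λ x → x ∉ H) where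
    open FinAbGroup G using (0ᴳ) renaming (n to N; _+ᴳ_ to infixl 6 _⊕_; _·_ to infixr 7 _·_)
    open Group G
    open Layers G p-prime
    open LayersAsInvariants G p-prime
    open Invariants G p p-prime using (r; α; expo; invTwoPow)

    private
      instance
        p≢0 : NonZero p
        p≢0 = prime⇒nonZero p-prime
      1<p : 1 < p
      1<p = prime⇒1<p p-prime

    open Weighted p

    Gᵇ Hᵇ : Fin N → Bool
    Gᵇ = lookup ⊤
    Hᵇ = lookup H

    ∈Gᵇ : ∀ x → Gᵇ x ≡ true
    ∈Gᵇ x = lookup-replicate x true

    G-sub : IsSubmonoid Gᵇ
    G-sub = record { 0∈ = ∈Gᵇ 0ᴳ ; ⊕∈ = λ {x} {y} _ _ → ∈Gᵇ (x ⊕ y) }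

    H-sub : IsSubmonoid Hᵇ
    H-sub = record
      { 0∈ = []=⇒lookup (FinAbGroup.IsSubgroup.0∈ H≤G)
      ; ⊕∈ = λ {x} {y} Hx Hy → []=⇒lookup (FinAbGroup.IsSubgroup.+∈ H≤G (lookup⇒[]= x H Hx) (lookup⇒[]= y H Hy)) }

    open Relative H-sub G-sub (λ x _ → ∈Gᵇ x) (λ y _ → []=⇒lookup (pG⊆H y))

    Δ : ℕ → ℕ
    Δ = drop relativeRank

    r-split : ∀ i → 1 ≤ i → i ≤ suc e → r i ⊤ ≡ r i H + Δ i
    r-split (suc i) _ _ = trans (r≡rank G-sub i) (trans (rank≡rank+drop i) (cong (_+ Δ (suc i)) (sym (r≡rank H-sub i))))

    G-annihilated : Annihilates (p ^ suc e) Gᵇ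
    G-annihilated a _ = pᵉ⁺¹G≡0 a

    G-not-annihilated : ¬ Annihilates (p ^ e) Gᵇ
    G-not-annihilated pᵉG≡0 = pᵉG≢0 (λ a → pᵉG≡0 a (∈Gᵇ a))

    sum₁Δ≡δ₀ : sum₁ Δ (suc e) ≡ relativeRank 0
    sum₁Δ≡δ₀ = begin
      sum₁ Δ (suc e)                             ≡⟨ +-identityʳ _ ⟨
      sum₁ Δ (suc e) + 0                         ≡⟨ cong (sum₁ Δ (suc e) +_) (annihilated⇒relativeRank≡0 {suc e} G-annihilated) ⟨
      sum₁ Δ (suc e) + relativeRank (suc e)      ≡⟨ sum₁-drop relativeRank (suc e) (λ i _ → relativeRank-antitone i) ⟩
      relativeRank 0                             ∎
      where open ≡-Reasoning

    δ₀≥1 : 1 ≤ relativeRank 0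
    δ₀≥1 = positive (proj₁ H≢G) (proj₂ H≢G)
      where
        positive : ∀ x → x ∉ H → 1 ≤ relativeRank 0
        positive x x∉H with Hᵇ x in Hx
        ... | false = relativeRank₀-positive Hx (∈Gᵇ x)
        ... | true  = ⊥-elim (x∉H (lookup⇒[]= x H Hx))

    weightedΔ≥1 : 1 ≤ weighted Δ (suc e)
    weightedΔ≥1 = ≤-trans δ₀≥1 (≤-trans (≤-reflexive (sym sum₁Δ≡δ₀)) (sum₁≤weighted Δ (suc e)))

    Exceptional : Set
    Exceptional = r (suc e) ⊤ ≡ 1 × r (suc e) H ≡ 0 × (∀ i → 1 ≤ i → i ≤ e → r i ⊤ ≡ r i H)

    -- weighted Δ ≤ 1 forces Δ to vanish below e+1, and then Δ (e+1) = Σ Δ = δ₀ ≥ 1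
    weightedΔ≥2 : r (suc e) H ≡ 0 → ¬ Exceptional → 2 ≤ weighted Δ (suc e)
    weightedΔ≥2 rH≡0 not-exceptional = ≮⇒≥ λ W<2 → not-exceptional (exceptional (≤-pred W<2))
      where
        exceptional : weighted Δ (suc e) ≤ 1 → Exceptional
        exceptional W≤1 = trans (r-split (suc e) (s≤s z≤n) ≤-refl) (cong₂ _+_ rH≡0 Δ₁₊ₑ≡1) , rH≡0 ,
                          λ i 1≤i i≤e → trans (r-split i 1≤i (m≤n⇒m≤1+n i≤e))
                                              (trans (cong (r i H +_) (Δᵢ≡0 i 1≤i i≤e)) (+-identityʳ _))
          where
            Wₑ≡0 : weighted Δ e ≡ 0
            Wₑ≡0 = weighted≤1⇒weighted-pred≡0 1<p Δ e W≤1
            Δᵢ≡0 : ∀ i → 1 ≤ i → i ≤ e → Δ i ≡ 0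
            Δᵢ≡0 = weighted≡0⇒≡0 Δ e Wₑ≡0
            Δ₁₊ₑ≡W : Δ (suc e) ≡ weighted Δ (suc e)
            Δ₁₊ₑ≡W = sym (trans (weighted-suc Δ e)
                                (trans (cong (λ w → p * w + Δ (suc e)) Wₑ≡0) (cong (_+ Δ (suc e)) (*-zeroʳ p))))
            Δ₁₊ₑ≡δ₀ : Δ (suc e) ≡ relativeRank 0
            Δ₁₊ₑ≡δ₀ = trans (cong (_+ Δ (suc e)) (sym (weighted≡0⇒sum₁≡0 Δ e Wₑ≡0))) sum₁Δ≡δ₀
            Δ₁₊ₑ≡1 : Δ (suc e) ≡ 1
            Δ₁₊ₑ≡1 = ≤-antisym (≤-trans (≤-reflexive Δ₁₊ₑ≡W) W≤1) (subst (1 ≤_) (sym Δ₁₊ₑ≡δ₀) δ₀≥1)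

    suc-e≤N : suc e ≤ N
    suc-e≤N = <⇒≤ (subst (suc e <_) (trans (count-cong ∈Gᵇ) count-true) (exponent<count G-sub G-annihilated G-not-annihilated))

    expo-G : expo ⊤ ≡ suc e
    expo-G = expo≡ ⊤ (suc e) suc-e≤N G-annihilated (λ j j<1+e pʲG≡0 → G-not-annihilated (annihilates-mono (≤-pred j<1+e) pʲG≡0))

    expo-H-full : ¬ Annihilates (p ^ e) Hᵇ → expo H ≡ suc e
    expo-H-full pᵉH≢0 = expo≡ H (suc e) suc-e≤N (λ a _ → pᵉ⁺¹G≡0 a)
                          (λ j j<1+e pʲH≡0 → pᵉH≢0 (annihilates-mono (≤-pred j<1+e) pʲH≡0))

    -- p G ⊆ H, so if p^j kills H then p^{j+1} kills G, which forces j ≥ e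
    expo-H-drop : Annihilates (p ^ e) Hᵇ → expo H ≡ e
    expo-H-drop pᵉH≡0 = expo≡ H e (≤-trans (n≤1+n e) suc-e≤N) pᵉH≡0
      (λ j j<e pʲH≡0 → G-not-annihilated (annihilates-mono j<e (λ a _ → pʲ⁺¹a≡0 {j} pʲH≡0 a)))
      where
        pʲ⁺¹a≡0 : ∀ {j} → Annihilates (p ^ j) Hᵇ → ∀ a → p ^ suc j · a ≡ 0ᴳ
        pʲ⁺¹a≡0 {j} pʲH≡0 a =
          trans (cong (_· a) (*-comm p (p ^ j))) (trans (·-assoc (p ^ j) p a) (pʲH≡0 (p · a) ([]=⇒lookup (pG⊆H a))))

    private
      P = p ^ suc e
      instance
        P≢0 : NonZero P
        P≢0 = m^n≢0 p (suc e)
        pᵉ≢0 : NonZero (p ^ e)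
        pᵉ≢0 = m^n≢0 p e
        2P≢0 : NonZero (2 * P)
        2P≢0 = m*n≢0 2 P

    rG rH : ℕ → ℕ
    rG i = r i ⊤
    rH i = r i H

    αG≡ : α ⊤ ≡ (ℤ.+ numerator rG (suc e)) ℚ./ P
    αG≡ = α≡ ⊤ (suc e) expo-G

    α-gap-full : ¬ Annihilates (p ^ e) Hᵇ → invTwoPow (suc e) ℚ.< α ⊤ ℚ.- α H
    α-gap-full pᵉH≢0 = subst₂ (λ a b → invTwoPow (suc e) ℚ.< a ℚ.- b) (sym αG≡) (sym (α≡ H (suc e) (expo-H-full pᵉH≢0)))
      (1/2P<X/P-Y/Q (numerator rG (suc e)) (numerator rH (suc e)) P 1 P (sym (*-identityʳ P))
        (subst (_< numerator rG (suc e)) (sym (*-identityˡ (numerator rH (suc e))))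
               (numerator-< 1<p {rG} {rH} {Δ} (suc e) r-split weightedΔ≥1)))

    α-gap-drop : Annihilates (p ^ e) Hᵇ → ¬ Exceptional → invTwoPow (suc e) ℚ.< α ⊤ ℚ.- α H
    α-gap-drop pᵉH≡0 not-exceptional =
      subst₂ (λ a b → invTwoPow (suc e) ℚ.< a ℚ.- b) (sym αG≡) (sym (α≡ H e (expo-H-drop pᵉH≡0)))
        (1/2P<X/P-Y/Q (numerator rG (suc e)) (numerator rH e) (p ^ e) p P (*-comm p (p ^ e))
          (p*numerator-< 1<p {rG} {rH} {Δ} e r-split rH≡0 (weightedΔ≥2 rH≡0 not-exceptional)))
      where
        rH≡0 : r (suc e) H ≡ 0
        rH≡0 = trans (r≡rank H-sub e) (annihilated⇒rank≡0 H-sub {e} pᵉH≡0)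

    α-gap : ¬ Exceptional → invTwoPow (suc e) ℚ.< α ⊤ ℚ.- α H
    α-gap not-exceptional = by-cases (annihilates? (p ^ e) Hᵇ)
      where
        by-cases : Dec (Annihilates (p ^ e) Hᵇ) → invTwoPow (suc e) ℚ.< α ⊤ ℚ.- α H
        by-cases (yes pᵉH≡0) = α-gap-drop pᵉH≡0 not-exceptional
        by-cases (no  pᵉH≢0) = α-gap-full pᵉH≢0

open AlphaGap using (module Proposition)
open import Defs
open import Data.Nat using (ℕ; _≤_; _∸_; _^_; _*_; suc; s≤s; z≤n)
open import Data.Nat.Primality using (Prime)
open import Data.Fin.Subset using (Subset; _∈_; _∉_; ⊤)
open import Data.Product using (_×_; ∃)
open import Relation.Nullary using (¬_)
open import Relation.Binary.PropositionalEquality using (_≡_)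
open import Data.Rational using (_<_; _-_)

proposition6p9 : (p : ℕ) (pr : Prime p) (G : FinAbGroup) (e : ℕ) → 1 ≤ e →
    (∀ x → _·_ G (p ^ e) x ≡ 0ᴳ G) →
    ¬ (∀ x → _·_ G (p ^ (e ∸ 1)) x ≡ 0ᴳ G) →
    (H : Subset (n G)) → IsSubgroup G H →
    (∀ x → _·_ G p x ∈ H) →
    (∃ λ x → x ∉ H) →
    ¬ (Invariants.r G p pr e ⊤ ≡ 1 × Invariants.r G p pr e H ≡ 0 ×
    (∀ i → 1 ≤ i → i ≤ e ∸ 1 → Invariants.r G p pr i ⊤ ≡ Invariants.r G p pr i H)) →
    Invariants.invTwoPow G p pr e < Invariants.α G p pr ⊤ - Invariants.α G p pr H
proposition6p9 p pr G (suc e) (s≤s z≤n) pᵉ⁺¹G≡0 pᵉG≢0 H H≤G pG⊆H H≢G =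
  Proposition.α-gap p pr G e pᵉ⁺¹G≡0 pᵉG≢0 H H≤G pG⊆H H≢G
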